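{- Let $\mathcal{A},\mathcal{B}\subseteq\Omega=\{0,1\}^n$ be increasing, with $\mu(\mathcal{B})=t$. If $$\mathrm{Cor}(\mathcal{A},\mathcal{B})\ge \tfrac14\sum_{k=1}^n I_k(\mathcal{A})I_k(\mathcal{B}),$$ then $$\mathrm{Cor}(\mathcal{A},\mathcal{B})\ge \tfrac12 I_{\min}(\mathcal{A})\, t\log_2(1/t).$$ In particular, if in addition $\mu(\mathcal{B})=1/2$, then $\mathrm{Cor}(\mathcal{A},\mathcal{B})\ge\tfrac14 I_{\min}(\mathcal{A})$.
   Context: Subsets of $[n]$ are identified with elements of $\Omega=\{0,1\}^n$; $\mu$ is the uniform probability measure on $\Omega$. A family is increasing if it is closed under taking supersets. $\mathrm{Cor}(\mathcal{A},\mathcal{B})=\mu(\mathcal{A}\cap\mathcal{B})-\mu(\mathcal{A})\mu(\mathcal{B})$. $I_k(\mathcal{A})=2\mu(\{x\in\mathcal{A}: x\oplus e_k\notin\mathcal{A}\})$, where $x\oplus e_k$ flips the $k$-th coordinate of $x$; $I_{\min}(\mathcal{A})=\min_k I_k(\mathcal{A})$. The convention $0\cdot\log_2(1/0)=0$ is used. -}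

module Defs where

open import Data.Bool using (Bool; true; false; _≤_)
open import Data.Nat as ℕ using (ℕ; zero; suc)
open import Data.Nat.Properties using (m^n≢0)
open import Data.Integer as ℤ using (ℤ; +_; -[1+_])
open import Data.Rational as ℚ using (ℚ; 0ℚ; 1ℚ; _+_; _*_; _-_)
open import Data.Fin using (Fin; zero; suc)
open import Data.List using (List; []; _∷_; map; _++_; filter; length; foldr)
open import Data.Product using (_×_)
open import Relation.Binary.PropositionalEquality using (_≡_)
open import Relation.Nullary using (Dec; yes; no)
open import Data.Bool.Properties using () renaming (_≟_ to _≟ᵇ_)

-- Ω = {0,1}^n, points are functions Fin n → Bool (true = element in the set)
Ω : ℕ → Set
Ω n = Fin n → Bool

Family : ℕ → Set
Family n = Ω n → Bool

cons : ∀ {n} → Bool → Ω n → Ω (suc n)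
cons b x zero    = b
cons b x (suc i) = x i

allPoints : (n : ℕ) → List (Ω n)
allPoints zero    = (λ ()) ∷ []
allPoints (suc n) = map (cons false) (allPoints n) ++ map (cons true) (allPoints n)

count : ∀ n → (Ω n → Bool) → ℕ
count n P = length (filter (λ x → P x ≟ᵇ true) (allPoints n))

μ : ∀ n → (Ω n → Bool) → ℚ
μ n P = (+ count n P) ℚ./ (2 ℕ.^ n) where instance _ = m^n≢0 2 n

_∩_ : ∀ {n} → Family n → Family n → Family n
(A ∩ B) x = Data.Bool._∧_ (A x) (B x)
  where import Data.Bool

_⊆_ : ∀ {n} → Ω n → Ω n → Set
x ⊆ y = ∀ i → x i ≤ y i

Increasing : ∀ {n} → Family n → Set
Increasing {n} A = ∀ (x y : Ω n) → x ⊆ y → A x ≡ true → A y ≡ true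

Cor : ∀ n → Family n → Family n → ℚ
Cor n A B = μ n (A ∩ B) - μ n A * μ n B

flip : ∀ {n} → Ω n → Fin n → Ω n
flip x k i with Data.Fin._≟_ k i
  where import Data.Fin
... | yes _ = Data.Bool.not (x i) where import Data.Bool
... | no  _ = x i

I : ∀ n → Fin n → Family n → ℚ
I n k A = (+ 2 ℚ./ 1) * μ n (λ x → Data.Bool._∧_ (A x) (Data.Bool.not (A (flip x k))))
  where import Data.Bool

allFin : (n : ℕ) → List (Fin n)
allFin zero    = []
allFin (suc n) = zero ∷ map suc (allFin n)

sumInfl : ∀ n → Family n → Family n → ℚ
sumInfl n A B = foldr (λ k s → I n k A * I n k B + s) 0ℚ (allFin n)

-- I_min(A) = min_k I_k(A), for n ≥ 1 (the minimum over an empty index set is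
-- undefined; we only use it for n = suc m)
Imin : ∀ m → Family (suc m) → ℚ
Imin m A = foldr (λ k s → I (suc m) k A ℚ.⊓ s) (I (suc m) zero A) (allFin (suc m))

_^_ : ℚ → ℕ → ℚ
q ^ zero  = 1ℚ
q ^ suc k = q * (q ^ k)

two : ℚ
two = + 2 ℚ./ 1

-- 2^(p) · t^q ≥ 1 for an integer p, written without negative powers:
-- for p = k ≥ 0:  1 ≤ t^q · 2^k ;  for p = -(k+1):  2^(k+1) ≤ t^q.
-- For q > 0 and t > 0 this says exactly  log₂(1/t) ≤ p/q.
Log₂InvLe : ℚ → ℤ → ℕ → Set
Log₂InvLe t (+ k)     q = 1ℚ ℚ.≤ (t ^ q) * (two ^ k)
Log₂InvLe t -[1+ k ]  q = two ^ suc k ℚ.≤ t ^ q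

-- "c ≥ b · log₂(1/t)" for rationals b ≥ 0, 0 ≤ t ≤ 1, with the convention
-- 0 · log₂(1/0) = 0 (so for t = 0 or b = 0 the right-hand side is 0).
-- For b > 0, t > 0:  c ≥ b log₂(1/t)  ⇔  log₂(1/t) ≤ c/b, and c/b = p/q is
-- checked for every representation (p,q) of c/b with q > 0.
GeTimesLog₂Inv : (c b t : ℚ) → Set
GeTimesLog₂Inv c b t =
  (t ≡ 0ℚ → 0ℚ ℚ.≤ c) ×
  (b ≡ 0ℚ → 0ℚ ℚ.≤ c) ×
  (0ℚ ℚ.< b → 0ℚ ℚ.< t →
     ∀ (p : ℤ) (q : ℕ) → 0 ℕ.< q → c * (+ q ℚ./ 1) ≡ b * (p ℚ./ 1) → Log₂InvLe t p q)

module Submission where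

-- Since I_k(A) ≥ I_min(A) and influences are nonnegative, the hypothesis gives
-- Cor(A,B) ≥ ¼ I_min(A) Σ_k I_k(B) = ½ I_min(A) |∂B| / 2ⁿ, where |∂B| counts the pairs (x, k)
-- with x ∈ B and x ⊕ e_k ∉ B. The edge-isoperimetric inequality
-- |∂B| ≥ |B| log₂(2ⁿ/|B|) = 2ⁿ t log₂(1/t), proved by induction on n by splitting B along the
-- first coordinate, turns this into Cor(A,B) ≥ ½ I_min(A) t log₂(1/t); for t = ½ it reads
-- |∂B| ≥ 2ⁿ⁻¹, whence Cor(A,B) ≥ ¼ I_min(A). Logarithms never appear: the isoperimetric
-- inequality is used in the form 2^(n|B|) ≤ |B|^|B| 2^|∂B|.

module Counting where

  open import Data.Bool using (Bool; true; false; not; _∧_)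
  open import Data.Bool.Properties using () renaming (_≟_ to _≟ᵇ_)
  open import Data.List using (List; []; _∷_; map; _++_; filter; length)
  open import Data.List.Properties using (length-++; filter-++; filter-≐)
  open import Data.Nat using (ℕ; suc; _+_; _≤_; z≤n; s≤s)
  open import Data.Nat.Properties using (≤-trans; n≤1+n; +-suc; ≤-reflexive)
  open import Data.Product using (_,_)
  open import Function using (_∘_)
  open import Relation.Binary.PropositionalEquality
  open import Defs using (Ω; cons; allPoints; count)

  countIn : ∀ {a} {A : Set a} → (A → Bool) → List A → ℕ
  countIn P xs = length (filter (λ x → P x ≟ᵇ true) xs)

  module _ {a} {A : Set a} where

    countIn-++ : ∀ (P : A → Bool) xs ys → countIn P (xs ++ ys) ≡ countIn P xs + countIn P ys
    countIn-++ P xs ys = trans (cong length (filter-++ _ xs ys)) (length-++ (filter _ xs))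

    countIn-map : ∀ {b} {B : Set b} (P : A → Bool) (f : B → A) xs →
                  countIn P (map f xs) ≡ countIn (P ∘ f) xs
    countIn-map P f [] = refl
    countIn-map P f (x ∷ xs) with P (f x)
    ... | true  = cong suc (countIn-map P f xs)
    ... | false = countIn-map P f xs

    countIn-cong : ∀ {P Q : A → Bool} → P ≗ Q → countIn P ≗ countIn Q
    countIn-cong {P} {Q} P≗Q xs =
      cong length (filter-≐ _ _ ((λ {x} → trans (sym (P≗Q x))) , (λ {x} → trans (P≗Q x))) xs)

    countIn-≤-+-diff : ∀ (P Q : A → Bool) xs →
                       countIn P xs ≤ countIn Q xs + countIn (λ x → P x ∧ not (Q x)) xs
    countIn-≤-+-diff P Q [] = z≤n
    countIn-≤-+-diff P Q (x ∷ xs) with P x | Q x | countIn-≤-+-diff P Q xs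
    ... | true  | true  | ih = s≤s ih
    ... | true  | false | ih = ≤-trans (s≤s ih) (≤-reflexive (sym (+-suc _ _)))
    ... | false | true  | ih = ≤-trans ih (n≤1+n _)
    ... | false | false | ih = ih

  count-cons : ∀ n (P : Ω (suc n) → Bool) →
               count (suc n) P ≡ count n (P ∘ cons false) + count n (P ∘ cons true)
  count-cons n P = trans (countIn-++ P (map (cons false) xs) (map (cons true) xs))
                         (cong₂ _+_ (countIn-map P (cons false) xs) (countIn-map P (cons true) xs))
    where xs = allPoints n

  count-cong : ∀ n {P Q : Ω n → Bool} → P ≗ Q → count n P ≡ count n Q
  count-cong n P≗Q = countIn-cong P≗Q (allPoints n)

  count-≤-+-diff : ∀ n (P Q : Ω n → Bool) → count n P ≤ count n Q + count n (λ x → P x ∧ not (Q x))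
  count-≤-+-diff n P Q = countIn-≤-+-diff P Q (allPoints n)

module Boundary where

  open import Data.Bool using (Bool; true; false; not; _∧_)
  import Data.Bool.Properties as Bool
  open import Data.Fin using (Fin; zero; suc)
  import Data.Fin as Fin
  open import Data.List using ([]; _∷_; map)
  open import Data.List.Properties using (map-∘; map-cong)
  open import Data.Nat using (ℕ; suc; _+_; _≤_)
  open import Data.Nat.ListAction using (sum)
  open import Data.Nat.Properties using (≤-trans; +-monoʳ-≤; m≤m+n; m≤n+m; ≤-reflexive)
  open import Data.Nat.Tactic.RingSolver using (solve-∀)
  open import Function using (_∘_)
  open import Relation.Binary.PropositionalEquality
  open import Relation.Nullary using (yes; no)
  open import Defs using (Ω; Family; cons; count; flip; allFin; _⊆_; Increasing)
  open Counting

  -- Points are functions, so without function extensionality a family need not respect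
  -- pointwise equality of points; increasing families do.
  Extensional : ∀ {n} → Family n → Set
  Extensional {n} B = ∀ {x y : Ω n} → x ≗ y → B x ≡ B y

  ≗⇒⊆ : ∀ {n} {x y : Ω n} → x ≗ y → x ⊆ y
  ≗⇒⊆ x≗y i = Bool.≤-reflexive (x≗y i)

  ≡true-ext : ∀ {a b : Bool} → (a ≡ true → b ≡ true) → (b ≡ true → a ≡ true) → a ≡ b
  ≡true-ext {false} {false} _   _   = refl
  ≡true-ext {false} {true}  _   b⇒a = b⇒a refl
  ≡true-ext {true}  {false} a⇒b _   = sym (a⇒b refl)
  ≡true-ext {true}  {true}  _   _   = refl

  increasing⇒extensional : ∀ {n} {B : Family n} → Increasing B → Extensional B
  increasing⇒extensional inc {x} {y} x≗y =
    ≡true-ext (inc x y (≗⇒⊆ x≗y)) (inc y x (≗⇒⊆ (sym ∘ x≗y)))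

  flip-cons-zero : ∀ {n} b (x : Ω n) → flip (cons b x) zero ≗ cons (not b) x
  flip-cons-zero b x zero    = refl
  flip-cons-zero b x (suc i) = refl

  flip-cons-suc : ∀ {n} b (x : Ω n) j → flip (cons b x) (suc j) ≗ cons b (flip x j)
  flip-cons-suc b x j zero = refl
  flip-cons-suc b x j (suc i) with j Fin.≟ i
  ... | yes _ = refl
  ... | no  _ = refl

  -- I_k(B) = 2 · boundary n B k / 2ⁿ, and edgeBoundary n B is the edge boundary |∂B|.
  boundary : ∀ n → Family n → Fin n → ℕ
  boundary n B k = count n (λ x → B x ∧ not (B (flip x k)))

  edgeBoundary : ∀ n → Family n → ℕ
  edgeBoundary n B = sum (map (boundary n B) (allFin n))

  sum-map-+ : ∀ {a} {A : Set a} (f g : A → ℕ) xs →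
              sum (map (λ x → f x + g x) xs) ≡ sum (map f xs) + sum (map g xs)
  sum-map-+ f g []       = refl
  sum-map-+ f g (x ∷ xs) = trans (cong (f x + g x +_) (sum-map-+ f g xs)) (interchange (f x) (g x) _ _)
    where
    interchange : ∀ a b c d → a + b + (c + d) ≡ a + c + (b + d)
    interchange = solve-∀

  module FirstCoordinate {n} (B : Family (suc n)) (ext : Extensional B) where

    B₀ B₁ : Family n
    B₀ = B ∘ cons false
    B₁ = B ∘ cons true

    B₀-extensional : Extensional B₀
    B₀-extensional x≗y = ext λ { zero → refl ; (suc i) → x≗y i }

    B₁-extensional : Extensional B₁
    B₁-extensional x≗y = ext λ { zero → refl ; (suc i) → x≗y i }

    boundary-zero : boundary (suc n) B zero
                  ≡ count n (λ x → B₀ x ∧ not (B₁ x)) + count n (λ x → B₁ x ∧ not (B₀ x))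
    boundary-zero = trans (count-cons n _) (cong₂ _+_
      (count-cong n (λ x → cong (λ z → B₀ x ∧ not z) (ext (flip-cons-zero false x))))
      (count-cong n (λ x → cong (λ z → B₁ x ∧ not z) (ext (flip-cons-zero true x)))))

    boundary-suc : ∀ j → boundary (suc n) B (suc j) ≡ boundary n B₀ j + boundary n B₁ j
    boundary-suc j = trans (count-cons n _) (cong₂ _+_
      (count-cong n (λ x → cong (λ z → B₀ x ∧ not z) (ext (flip-cons-suc false x j))))
      (count-cong n (λ x → cong (λ z → B₁ x ∧ not z) (ext (flip-cons-suc true x j)))))

    edgeBoundary-cons : edgeBoundary (suc n) B
                      ≡ boundary (suc n) B zero + (edgeBoundary n B₀ + edgeBoundary n B₁)
    edgeBoundary-cons = cong (boundary (suc n) B zero +_) (begin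
      sum (map (boundary (suc n) B) (map suc (allFin n)))
        ≡⟨ cong sum (sym (map-∘ (allFin n))) ⟩
      sum (map (boundary (suc n) B ∘ suc) (allFin n))
        ≡⟨ cong sum (map-cong boundary-suc (allFin n)) ⟩
      sum (map (λ j → boundary n B₀ j + boundary n B₁ j) (allFin n))
        ≡⟨ sum-map-+ (boundary n B₀) (boundary n B₁) (allFin n) ⟩
      edgeBoundary n B₀ + edgeBoundary n B₁ ∎)
      where open ≡-Reasoning

    count₁≤count₀+boundary : count n B₁ ≤ count n B₀ + boundary (suc n) B zero
    count₁≤count₀+boundary = ≤-trans (count-≤-+-diff n B₁ B₀)
      (≤-trans (+-monoʳ-≤ (count n B₀) (m≤n+m _ _)) (≤-reflexive (cong (count n B₀ +_) (sym boundary-zero))))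

    count₀≤count₁+boundary : count n B₀ ≤ count n B₁ + boundary (suc n) B zero
    count₀≤count₁+boundary = ≤-trans (count-≤-+-diff n B₀ B₁)
      (≤-trans (+-monoʳ-≤ (count n B₁) (m≤m+n _ _)) (≤-reflexive (cong (count n B₁ +_) (sym boundary-zero))))

module EdgeIsoperimetry where

  open import Data.Nat
  open import Data.Nat.Properties
  open import Data.Nat.Tactic.RingSolver using (solve-∀)
  open import Data.Product using (_,_)
  open import Data.Sum using (inj₁; inj₂)
  open import Relation.Binary.PropositionalEquality
  open import Defs using (Family; count)
  open Counting using (count-cons)
  open Boundary using (Extensional; edgeBoundary; module FirstCoordinate)

  ^-distribʳ-* : ∀ m n o → (m * n) ^ o ≡ m ^ o * n ^ o
  ^-distribʳ-* m n zero    = refl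
  ^-distribʳ-* m n (suc o) = trans (cong (m * n *_) (^-distribʳ-* m n o)) (interchange m n (m ^ o) (n ^ o))
    where
    interchange : ∀ w x y z → w * x * (y * z) ≡ w * y * (x * z)
    interchange = solve-∀

  4a[a+c]≤[a+[a+c]]² : ∀ a c → 4 * a * (a + c) ≤ (a + (a + c)) * (a + (a + c))
  4a[a+c]≤[a+[a+c]]² a c = ≤-trans (m≤m+n _ (c * c)) (≤-reflexive (square a c))
    where
    square : ∀ a c → 4 * a * (a + c) + c * c ≡ (a + (a + c)) * (a + (a + c))
    square = solve-∀

  -- (a+b)^(a+b) / (a^a b^b) = 2^((a+b) H(a/(a+b))), so this is the entropy bound H(x) ≥ 2x for x ≤ ½.
  4^a*a^a*b^b≤[a+b]^[a+b] : ∀ {a b} → a ≤ b → 4 ^ a * a ^ a * b ^ b ≤ (a + b) ^ (a + b)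
  4^a*a^a*b^b≤[a+b]^[a+b] {a} a≤b with m≤n⇒∃[o]m+o≡n a≤b
  ... | c , refl = begin
    4 ^ a * a ^ a * b ^ b
      ≡⟨ cong (4 ^ a * a ^ a *_) (^-distribˡ-+-* b a c) ⟩
    4 ^ a * a ^ a * (b ^ a * b ^ c)
      ≡⟨ regroup (4 ^ a) (a ^ a) (b ^ a) (b ^ c) ⟩
    4 ^ a * a ^ a * b ^ a * b ^ c
      ≡⟨ cong (λ z → z * b ^ a * b ^ c) (sym (^-distribʳ-* 4 a a)) ⟩
    (4 * a) ^ a * b ^ a * b ^ c
      ≡⟨ cong (_* b ^ c) (sym (^-distribʳ-* (4 * a) b a)) ⟩
    (4 * a * b) ^ a * b ^ c
      ≤⟨ *-mono-≤ (^-monoˡ-≤ a (4a[a+c]≤[a+[a+c]]² a c)) (^-monoˡ-≤ c (m≤n+m b a)) ⟩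
    (s * s) ^ a * s ^ c
      ≡⟨ cong (_* s ^ c) (^-distribʳ-* s s a) ⟩
    s ^ a * s ^ a * s ^ c
      ≡⟨ sym (trans (^-distribˡ-+-* s (a + a) c) (cong (_* s ^ c) (^-distribˡ-+-* s a a))) ⟩
    s ^ (a + a + c)
      ≡⟨ cong (s ^_) (+-assoc a a c) ⟩
    s ^ (a + b) ∎
    where
    open ≤-Reasoning
    b = a + c
    s = a + b
    regroup : ∀ w x y z → w * x * (y * z) ≡ w * x * y * z
    regroup = solve-∀

  isoperimetric-step-≤ : ∀ n {a b E₀ E₁ e} →
    2 ^ (n * a) ≤ a ^ a * 2 ^ E₀ → 2 ^ (n * b) ≤ b ^ b * 2 ^ E₁ → a ≤ b → b ≤ a + e →
    2 ^ (suc n * (a + b)) ≤ (a + b) ^ (a + b) * 2 ^ (e + (E₀ + E₁))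
  isoperimetric-step-≤ n {a} {b} {E₀} {E₁} {e} h₀ h₁ a≤b b≤a+e with m≤n⇒∃[o]m+o≡n a≤b
  ... | c , refl = begin
    2 ^ (suc n * (a + b))
      ≡⟨ 2^-split ⟩
    2 ^ (a + b) * (2 ^ (n * a) * 2 ^ (n * b))
      ≤⟨ *-monoʳ-≤ (2 ^ (a + b)) (*-mono-≤ h₀ h₁) ⟩
    2 ^ (a + b) * (a ^ a * 2 ^ E₀ * (b ^ b * 2 ^ E₁))
      ≡⟨ cong (_* (a ^ a * 2 ^ E₀ * (b ^ b * 2 ^ E₁))) 2^[a+b]≡4^a*2^c ⟩
    4 ^ a * 2 ^ c * (a ^ a * 2 ^ E₀ * (b ^ b * 2 ^ E₁))
      ≡⟨ regroup (4 ^ a) (2 ^ c) (a ^ a) (2 ^ E₀) (b ^ b) (2 ^ E₁) ⟩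
    4 ^ a * a ^ a * b ^ b * 2 ^ c * (2 ^ E₀ * 2 ^ E₁)
      ≤⟨ *-monoˡ-≤ (2 ^ E₀ * 2 ^ E₁)
           (*-mono-≤ (4^a*a^a*b^b≤[a+b]^[a+b] a≤b) (^-monoʳ-≤ 2 (+-cancelˡ-≤ a c e b≤a+e))) ⟩
    (a + b) ^ (a + b) * 2 ^ e * (2 ^ E₀ * 2 ^ E₁)
      ≡⟨ *-assoc ((a + b) ^ (a + b)) (2 ^ e) _ ⟩
    (a + b) ^ (a + b) * (2 ^ e * (2 ^ E₀ * 2 ^ E₁))
      ≡⟨ cong ((a + b) ^ (a + b) *_) 2^[e+[E₀+E₁]] ⟨
    (a + b) ^ (a + b) * 2 ^ (e + (E₀ + E₁)) ∎
    where
    open ≤-Reasoning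
    regroup : ∀ f t x u y v → f * t * (x * u * (y * v)) ≡ f * x * y * t * (u * v)
    regroup = solve-∀
    2^-split : 2 ^ (suc n * (a + b)) ≡ 2 ^ (a + b) * (2 ^ (n * a) * 2 ^ (n * b))
    2^-split = trans (^-distribˡ-+-* 2 (a + b) (n * (a + b)))
      (cong (2 ^ (a + b) *_) (trans (cong (2 ^_) (*-distribˡ-+ n a b)) (^-distribˡ-+-* 2 (n * a) (n * b))))
    2^[a+b]≡4^a*2^c : 2 ^ (a + b) ≡ 4 ^ a * 2 ^ c
    2^[a+b]≡4^a*2^c = begin-equality
      2 ^ (a + (a + c))     ≡⟨ cong (2 ^_) (+-assoc a a c) ⟨
      2 ^ (a + a + c)       ≡⟨ ^-distribˡ-+-* 2 (a + a) c ⟩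
      2 ^ (a + a) * 2 ^ c   ≡⟨ cong (_* 2 ^ c) (^-distribˡ-+-* 2 a a) ⟩
      2 ^ a * 2 ^ a * 2 ^ c ≡⟨ cong (_* 2 ^ c) (^-distribʳ-* 2 2 a) ⟨
      4 ^ a * 2 ^ c         ∎
    2^[e+[E₀+E₁]] : 2 ^ (e + (E₀ + E₁)) ≡ 2 ^ e * (2 ^ E₀ * 2 ^ E₁)
    2^[e+[E₀+E₁]] = trans (^-distribˡ-+-* 2 e (E₀ + E₁)) (cong (2 ^ e *_) (^-distribˡ-+-* 2 E₀ E₁))

  isoperimetric-step : ∀ n {a b E₀ E₁ e} →
    2 ^ (n * a) ≤ a ^ a * 2 ^ E₀ → 2 ^ (n * b) ≤ b ^ b * 2 ^ E₁ → a ≤ b + e → b ≤ a + e →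
    2 ^ (suc n * (a + b)) ≤ (a + b) ^ (a + b) * 2 ^ (e + (E₀ + E₁))
  isoperimetric-step n {a} {b} {E₀} {E₁} {e} h₀ h₁ a≤b+e b≤a+e with ≤-total a b
  ... | inj₁ a≤b = isoperimetric-step-≤ n {E₀ = E₀} {E₁} h₀ h₁ a≤b b≤a+e
  ... | inj₂ b≤a = subst₂ (λ s E → 2 ^ (suc n * s) ≤ s ^ s * 2 ^ (e + E)) (+-comm b a) (+-comm E₁ E₀)
                     (isoperimetric-step-≤ n {E₀ = E₁} {E₀} h₁ h₀ b≤a a≤b+e)

  ^-cancelˡ-≤ : ∀ {m o} n .{{_ : NonZero n}} → m ^ n ≤ o ^ n → m ≤ o
  ^-cancelˡ-≤ n mⁿ≤oⁿ = ≮⇒≥ (λ o<m → <⇒≱ (^-monoˡ-< n o<m) mⁿ≤oⁿ)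

  2^-cancel-≤ : ∀ {m n} → 2 ^ m ≤ 2 ^ n → m ≤ n
  2^-cancel-≤ 2ᵐ≤2ⁿ = ≮⇒≥ (λ n<m → <⇒≱ (^-monoʳ-< 2 (s≤s (s≤s z≤n)) n<m) 2ᵐ≤2ⁿ)

  ^-comm-^ : ∀ m n o → (m ^ n) ^ o ≡ (m ^ o) ^ n
  ^-comm-^ m n o = trans (^-*-assoc m n o) (trans (cong (m ^_) (*-comm n o)) (sym (^-*-assoc m o n)))

  -- In logarithms: N S ≤ S log₂ S + E and E/S ≤ k/q give N ≤ log₂ S + k/q.
  isoperimetric-rescale : ∀ N S E q k .{{_ : NonZero S}} →
    2 ^ (N * S) ≤ S ^ S * 2 ^ E → E * q ≤ S * k → (2 ^ N) ^ q ≤ S ^ q * 2 ^ k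
  isoperimetric-rescale N S E q k iso Eq≤Sk = ^-cancelˡ-≤ S (begin
    ((2 ^ N) ^ q) ^ S       ≡⟨ ^-comm-^ (2 ^ N) q S ⟩
    ((2 ^ N) ^ S) ^ q       ≡⟨ cong (_^ q) (^-*-assoc 2 N S) ⟩
    (2 ^ (N * S)) ^ q       ≤⟨ ^-monoˡ-≤ q iso ⟩
    (S ^ S * 2 ^ E) ^ q     ≡⟨ ^-distribʳ-* (S ^ S) (2 ^ E) q ⟩
    (S ^ S) ^ q * (2 ^ E) ^ q ≡⟨ cong₂ _*_ (^-comm-^ S S q) (^-*-assoc 2 E q) ⟩
    (S ^ q) ^ S * 2 ^ (E * q) ≤⟨ *-monoʳ-≤ ((S ^ q) ^ S) (^-monoʳ-≤ 2 Eq≤Sk) ⟩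
    (S ^ q) ^ S * 2 ^ (S * k) ≡⟨ cong (λ z → (S ^ q) ^ S * 2 ^ z) (*-comm S k) ⟩
    (S ^ q) ^ S * 2 ^ (k * S) ≡⟨ cong ((S ^ q) ^ S *_) (sym (^-*-assoc 2 k S)) ⟩
    (S ^ q) ^ S * (2 ^ k) ^ S ≡⟨ sym (^-distribʳ-* (S ^ q) (2 ^ k) S) ⟩
    (S ^ q * 2 ^ k) ^ S     ∎)
    where open ≤-Reasoning

  half-cube-boundary : ∀ m E → 2 ^ (suc m * 2 ^ m) ≤ (2 ^ m) ^ (2 ^ m) * 2 ^ E → 2 ^ m ≤ E
  half-cube-boundary m E iso = 2^-cancel-≤ (*-cancelʳ-≤ (2 ^ S) (2 ^ E) (2 ^ (m * S)) {{m^n≢0 2 (m * S)}} (begin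
    2 ^ S * 2 ^ (m * S)  ≡⟨ sym (^-distribˡ-+-* 2 S (m * S)) ⟩
    2 ^ (suc m * S)      ≤⟨ iso ⟩
    (2 ^ m) ^ S * 2 ^ E  ≡⟨ cong (_* 2 ^ E) (^-*-assoc 2 m S) ⟩
    2 ^ (m * S) * 2 ^ E  ≡⟨ *-comm (2 ^ (m * S)) (2 ^ E) ⟩
    2 ^ E * 2 ^ (m * S)  ∎))
    where
    open ≤-Reasoning
    S = 2 ^ m

  1≤n^n : ∀ n → 1 ≤ n ^ n
  1≤n^n zero    = ≤-refl
  1≤n^n (suc n) = m^n>0 (suc n) (suc n)

  -- In the induction step ∂B consists of ∂B₀, ∂B₁ and the edges in direction 0, of which
  -- there are at least ||B₀| - |B₁||.
  edge-isoperimetry : ∀ n (B : Family n) → Extensional B →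
    2 ^ (n * count n B) ≤ count n B ^ count n B * 2 ^ edgeBoundary n B
  edge-isoperimetry zero    B _   = *-mono-≤ (1≤n^n (count 0 B)) (m^n>0 2 (edgeBoundary 0 B))
  edge-isoperimetry (suc n) B ext rewrite count-cons n B | FirstCoordinate.edgeBoundary-cons B ext =
    isoperimetric-step n {E₀ = edgeBoundary n B₀} {edgeBoundary n B₁}
      (edge-isoperimetry n B₀ B₀-extensional) (edge-isoperimetry n B₁ B₁-extensional)
      count₀≤count₁+boundary count₁≤count₀+boundary
    where open FirstCoordinate B ext

module RationalArithmetic where

  open import Data.Nat as ℕ using (ℕ; zero; suc)
  import Data.Nat.Properties as ℕ
  open import Data.Nat.Divisibility using (∣1⇒≡1)
  open import Data.Integer as ℤ using (+_)
  import Data.Integer.Properties as ℤ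
  open import Data.Rational
  open import Data.Rational.Properties
  import Data.Rational.Unnormalised as ℚᵘ
  import Data.Rational.Unnormalised.Properties as ℚᵘ
  open import Data.Rational.Solver using (module +-*-Solver)
  open import Data.Product using (_,_)
  open import Relation.Binary.PropositionalEquality
  open import Relation.Nullary using (contradiction)
  open import Algebra.Bundles using (CommutativeMonoid)
  open import Algebra.Properties.CommutativeSemigroup (CommutativeMonoid.commutativeSemigroup *-1-commutativeMonoid)
    using (interchange; xy∙z≈xz∙y)
  open import Defs using (two; _^_)

  -- Defs writes embedded naturals as + n / 1, so such terms are toℚ n by definition.
  toℚ : ℕ → ℚ
  toℚ n = + n / 1

  toℚ≡mkℚ : ∀ n → toℚ n ≡ mkℚ (+ n) 0 (λ (_ , d∣1) → ∣1⇒≡1 d∣1)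
  toℚ≡mkℚ n = normalize-coprime _

  toℚ-homo-+ : ∀ m n → toℚ (m ℕ.+ n) ≡ toℚ m + toℚ n
  toℚ-homo-+ m n rewrite toℚ≡mkℚ m | toℚ≡mkℚ n =
    cong (_/ 1) (sym (cong₂ ℤ._+_ (ℤ.*-identityʳ (+ m)) (ℤ.*-identityʳ (+ n))))

  toℚ-homo-* : ∀ m n → toℚ (m ℕ.* n) ≡ toℚ m * toℚ n
  toℚ-homo-* m n rewrite toℚ≡mkℚ m | toℚ≡mkℚ n = cong (_/ 1) (ℤ.pos-* m n)

  toℚ-mono-≤ : ∀ {m n} → m ℕ.≤ n → toℚ m ≤ toℚ n
  toℚ-mono-≤ {m} {n} m≤n rewrite toℚ≡mkℚ m | toℚ≡mkℚ n =
    *≤* (subst₂ ℤ._≤_ (sym (ℤ.*-identityʳ (+ m))) (sym (ℤ.*-identityʳ (+ n))) (ℤ.+≤+ m≤n))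

  toℚ-cancel-≤ : ∀ {m n} → toℚ m ≤ toℚ n → m ℕ.≤ n
  toℚ-cancel-≤ {m} {n} le rewrite toℚ≡mkℚ m | toℚ≡mkℚ n =
    ℤ.drop‿+≤+ (subst₂ ℤ._≤_ (ℤ.*-identityʳ (+ m)) (ℤ.*-identityʳ (+ n)) (drop-*≤* le))

  toℚ-injective : ∀ {m n} → toℚ m ≡ toℚ n → m ≡ n
  toℚ-injective eq = ℕ.≤-antisym (toℚ-cancel-≤ (≤-reflexive eq)) (toℚ-cancel-≤ (≤-reflexive (sym eq)))

  toℚ-homo-^ : ∀ m k → toℚ m ^ k ≡ toℚ (m ℕ.^ k)
  toℚ-homo-^ m zero    = refl
  toℚ-homo-^ m (suc k) = trans (cong (toℚ m *_) (toℚ-homo-^ m k)) (sym (toℚ-homo-* m (m ℕ.^ k)))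

  toℚ-nonNeg : ∀ n → 0ℚ ≤ toℚ n
  toℚ-nonNeg n = toℚ-mono-≤ {0} {n} ℕ.z≤n

  *-nonNeg : ∀ {p q} → 0ℚ ≤ p → 0ℚ ≤ q → 0ℚ ≤ p * q
  *-nonNeg {p} {q} 0≤p 0≤q = nonNegative⁻¹ _ {{nonNeg*nonNeg⇒nonNeg p {{nonNegative 0≤p}} q {{nonNegative 0≤q}}}}

  toℚ-pos : ∀ n .{{_ : ℕ.NonZero n}} → 0ℚ < toℚ n
  toℚ-pos (suc n) = <-≤-trans (positive⁻¹ 1ℚ) (toℚ-mono-≤ {1} {suc n} (ℕ.s≤s ℕ.z≤n))

  n/d*d≡n : ∀ n d .{{_ : ℕ.NonZero d}} → (+ n / d) * toℚ d ≡ toℚ n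
  n/d*d≡n n (suc d) = toℚᵘ-injective (ℚᵘ.≃-trans (toℚᵘ-homo-* (+ n / suc d) (toℚ (suc d)))
    (ℚᵘ.≃-trans (ℚᵘ.*-cong (toℚᵘ-fromℚᵘ (ℚᵘ.mkℚᵘ (+ n) d)) (toℚᵘ-fromℚᵘ (ℚᵘ.mkℚᵘ (+ suc d) 0)))
    (ℚᵘ.≃-trans cancel (ℚᵘ.≃-sym (toℚᵘ-fromℚᵘ (ℚᵘ.mkℚᵘ (+ n) 0))))))
    where
    cancel : ℚᵘ.mkℚᵘ (+ n) d ℚᵘ.* ℚᵘ.mkℚᵘ (+ suc d) 0 ℚᵘ.≃ ℚᵘ.mkℚᵘ (+ n) 0
    cancel = ℚᵘ.*≡* (trans (ℤ.*-identityʳ _) (cong (λ z → + n ℤ.* + suc z) (sym (ℕ.*-identityʳ d))))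

  nonZero-of-/-pos : ∀ n d .{{_ : ℕ.NonZero d}} → 0ℚ < + n / d → ℕ.NonZero n
  nonZero-of-/-pos zero    d 0<0/d = contradiction (sym (0/n≡0 d)) (<⇒≢ 0<0/d)
  nonZero-of-/-pos (suc n) d _     = _

  ^-distribʳ-* : ∀ p q k → (p * q) ^ k ≡ p ^ k * q ^ k
  ^-distribʳ-* p q zero    = refl
  ^-distribʳ-* p q (suc k) = trans (cong (p * q *_) (^-distribʳ-* p q k)) (interchange p q (p ^ k) (q ^ k))

  1≤t^q*2^k : ∀ {t} D S q k .{{_ : ℕ.NonZero D}} →
    t * toℚ D ≡ toℚ S → D ℕ.^ q ℕ.≤ S ℕ.^ q ℕ.* 2 ℕ.^ k → 1ℚ ≤ t ^ q * two ^ k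
  1≤t^q*2^k {t} D S q k td≡S Dᵠ≤Sᵠ2ᵏ = *-cancelʳ-≤-pos (toℚ D ^ q) {{positive 0<Dᵠ}} (begin
    1ℚ * toℚ D ^ q                  ≡⟨ *-identityˡ _ ⟩
    toℚ D ^ q                       ≡⟨ toℚ-homo-^ D q ⟩
    toℚ (D ℕ.^ q)                   ≤⟨ toℚ-mono-≤ Dᵠ≤Sᵠ2ᵏ ⟩
    toℚ (S ℕ.^ q ℕ.* 2 ℕ.^ k)       ≡⟨ toℚ-homo-* (S ℕ.^ q) (2 ℕ.^ k) ⟩
    toℚ (S ℕ.^ q) * toℚ (2 ℕ.^ k)   ≡⟨ cong₂ _*_ (trans (cong (_^ q) td≡S) (toℚ-homo-^ S q)) (toℚ-homo-^ 2 k) ⟨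
    (t * toℚ D) ^ q * two ^ k       ≡⟨ cong (_* two ^ k) (^-distribʳ-* t (toℚ D) q) ⟩
    t ^ q * toℚ D ^ q * two ^ k     ≡⟨ xy∙z≈xz∙y (t ^ q) (toℚ D ^ q) (two ^ k) ⟩
    t ^ q * two ^ k * toℚ D ^ q     ∎)
    where
    open ≤-Reasoning
    0<Dᵠ : 0ℚ < toℚ D ^ q
    0<Dᵠ = subst (0ℚ <_) (sym (toℚ-homo-^ D q)) (toℚ-pos (D ℕ.^ q) {{ℕ.m^n≢0 D q}})

  -- ¼ * toℚ 2 normalises to ½, so rearrangements below trade one for the other by computation.
  ¼ : ℚ
  ¼ = + 1 / 4

  cross-multiply : ∀ {h e c d t s q r} → 0ℚ < h → 0ℚ ≤ q →
    h * e ≤ c * d → t * d ≡ s → c * q ≡ h * t * r → e * q ≤ s * r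
  cross-multiply {h} {e} {c} {d} {t} {s} {q} {r} 0<h 0≤q he≤cd td≡s cq≡htr =
    *-cancelˡ-≤-pos h {{positive 0<h}} (begin
    h * (e * q)     ≡⟨ *-assoc h e q ⟨
    h * e * q       ≤⟨ *-monoʳ-≤-nonNeg q {{nonNegative 0≤q}} he≤cd ⟩
    c * d * q       ≡⟨ xy∙z≈xz∙y c d q ⟩
    c * q * d       ≡⟨ cong (_* d) cq≡htr ⟩
    h * t * r * d   ≡⟨ shuffle h t r d ⟩
    h * (t * d * r) ≡⟨ cong (λ z → h * (z * r)) td≡s ⟩
    h * (s * r)     ∎)
    where
    open ≤-Reasoning
    open +-*-Solver
    shuffle : ∀ a b c d → a * b * c * d ≡ a * (b * d * c)
    shuffle = solve 4 (λ a b c d → a :* b :* c :* d := a :* (b :* d :* c)) refl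

  ¼J≤c : ∀ {J c d e} → 0ℚ ≤ J → 0ℚ < d → d ≤ e → ½ * J * e ≤ c * (toℚ 2 * d) → ¼ * J ≤ c
  ¼J≤c {J} {c} {d} {e} 0≤J 0<d d≤e bound = *-cancelʳ-≤-pos (toℚ 2 * d) {{positive 0<2d}} (begin
    ¼ * J * (toℚ 2 * d) ≡⟨ shuffle ¼ J (toℚ 2) d ⟩
    ½ * J * d           ≤⟨ *-monoˡ-≤-nonNeg (½ * J) {{nonNegative 0≤½J}} d≤e ⟩
    ½ * J * e           ≤⟨ bound ⟩
    c * (toℚ 2 * d)     ∎)
    where
    open ≤-Reasoning
    open +-*-Solver
    shuffle : ∀ a b c d → a * b * (c * d) ≡ a * c * b * d
    shuffle = solve 4 (λ a b c d → a :* b :* (c :* d) := a :* c :* b :* d) refl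
    0<2d : 0ℚ < toℚ 2 * d
    0<2d = positive⁻¹ _ {{pos*pos⇒pos (toℚ 2) {{positive (toℚ-pos 2)}} d {{positive 0<d}}}}
    0≤½J : 0ℚ ≤ ½ * J
    0≤½J = *-nonNeg (nonNegative⁻¹ ½) 0≤J

module Influence where

  open import Data.Nat as ℕ using (ℕ; suc)
  import Data.Nat.Properties as ℕ
  open import Data.Integer as ℤ using (+_; -[1+_])
  open import Data.Rational
  open import Data.Rational.Properties
  open import Data.Rational.Solver using (module +-*-Solver)
  open import Data.Fin using (Fin; zero)
  open import Data.List using (List; []; _∷_; foldr; map)
  open import Data.List.Relation.Unary.All as All using (All; []; _∷_)
  open import Data.Nat.ListAction using (sum)
  open import Relation.Binary.PropositionalEquality
  open import Relation.Nullary using (contradiction)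
  open import Defs using (Family; μ; I; Imin; count; allFin; sumInfl; Cor; Log₂InvLe)
  open Boundary using (Extensional; boundary; edgeBoundary)
  open EdgeIsoperimetry using (edge-isoperimetry; isoperimetric-rescale; half-cube-boundary)
  open RationalArithmetic

  μ-nonNeg : ∀ n P → 0ℚ ≤ μ n P
  μ-nonNeg n P = nonNegative⁻¹ (μ n P) {{normalize-nonNeg (count n P) (2 ℕ.^ n) {{ℕ.m^n≢0 2 n}}}}

  μ*2ⁿ≡count : ∀ n P → μ n P * toℚ (2 ℕ.^ n) ≡ toℚ (count n P)
  μ*2ⁿ≡count n P = n/d*d≡n (count n P) (2 ℕ.^ n) {{ℕ.m^n≢0 2 n}}

  count≡2^m : ∀ m (B : Family (suc m)) → μ (suc m) B ≡ ½ → count (suc m) B ≡ 2 ℕ.^ m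
  count≡2^m m B t≡½ = toℚ-injective (begin
    toℚ (count (suc m) B)              ≡⟨ μ*2ⁿ≡count (suc m) B ⟨
    μ (suc m) B * toℚ (2 ℕ.^ suc m)    ≡⟨ cong₂ _*_ t≡½ (toℚ-homo-* 2 (2 ℕ.^ m)) ⟩
    ½ * (toℚ 2 * toℚ (2 ℕ.^ m))        ≡⟨ *-assoc ½ (toℚ 2) (toℚ (2 ℕ.^ m)) ⟨
    1ℚ * toℚ (2 ℕ.^ m)                 ≡⟨ *-identityˡ _ ⟩
    toℚ (2 ℕ.^ m)                      ∎)
    where open ≡-Reasoning

  I-nonNeg : ∀ n k A → 0ℚ ≤ I n k A
  I-nonNeg n k A = *-nonNeg (toℚ-nonNeg 2) (μ-nonNeg n _)

  I*2ⁿ≡2*boundary : ∀ n k A → I n k A * toℚ (2 ℕ.^ n) ≡ toℚ (2 ℕ.* boundary n A k)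
  I*2ⁿ≡2*boundary n k A = begin
    toℚ 2 * μ n _ * toℚ (2 ℕ.^ n)   ≡⟨ *-assoc (toℚ 2) (μ n _) _ ⟩
    toℚ 2 * (μ n _ * toℚ (2 ℕ.^ n)) ≡⟨ cong (toℚ 2 *_) (μ*2ⁿ≡count n _) ⟩
    toℚ 2 * toℚ (boundary n A k)    ≡⟨ toℚ-homo-* 2 (boundary n A k) ⟨
    toℚ (2 ℕ.* boundary n A k)      ∎
    where open ≡-Reasoning

  influenceSum : ∀ n → Family n → List (Fin n) → ℚ
  influenceSum n B ks = foldr (λ k s → I n k B + s) 0ℚ ks

  influenceSum*2ⁿ : ∀ n B ks →
    influenceSum n B ks * toℚ (2 ℕ.^ n) ≡ toℚ (2 ℕ.* sum (map (boundary n B) ks))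
  influenceSum*2ⁿ n B []       = *-zeroˡ (toℚ (2 ℕ.^ n))
  influenceSum*2ⁿ n B (k ∷ ks) = begin
    (I n k B + influenceSum n B ks) * δ
      ≡⟨ *-distribʳ-+ δ (I n k B) _ ⟩
    I n k B * δ + influenceSum n B ks * δ
      ≡⟨ cong₂ _+_ (I*2ⁿ≡2*boundary n k B) (influenceSum*2ⁿ n B ks) ⟩
    toℚ (2 ℕ.* boundary n B k) + toℚ (2 ℕ.* sum (map (boundary n B) ks))
      ≡⟨ toℚ-homo-+ (2 ℕ.* boundary n B k) _ ⟨
    toℚ (2 ℕ.* boundary n B k ℕ.+ 2 ℕ.* sum (map (boundary n B) ks))
      ≡⟨ cong toℚ (ℕ.*-distribˡ-+ 2 (boundary n B k) _) ⟨
    toℚ (2 ℕ.* sum (map (boundary n B) (k ∷ ks))) ∎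
    where
    open ≡-Reasoning
    δ = toℚ (2 ℕ.^ n)

  foldr-⊓-≤ : ∀ {a} {K : Set a} (f : K → ℚ) init ks → All (λ k → foldr (λ k s → f k ⊓ s) init ks ≤ f k) ks
  foldr-⊓-≤ f init []       = []
  foldr-⊓-≤ f init (k ∷ ks) = p⊓q≤p (f k) _ ∷ All.map (≤-trans (p⊓q≤q (f k) _)) (foldr-⊓-≤ f init ks)

  foldr-⊓-nonNeg : ∀ {a} {K : Set a} (f : K → ℚ) {init} → (∀ k → 0ℚ ≤ f k) → 0ℚ ≤ init →
    ∀ ks → 0ℚ ≤ foldr (λ k s → f k ⊓ s) init ks
  foldr-⊓-nonNeg f f≥0 init≥0 []       = init≥0
  foldr-⊓-nonNeg f f≥0 init≥0 (k ∷ ks) = ⊓-glb (f≥0 k) (foldr-⊓-nonNeg f f≥0 init≥0 ks)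

  Imin-nonNeg : ∀ m A → 0ℚ ≤ Imin m A
  Imin-nonNeg m A =
    foldr-⊓-nonNeg (λ k → I (suc m) k A) (λ k → I-nonNeg (suc m) k A) (I-nonNeg (suc m) zero A) (allFin (suc m))

  Imin≤I : ∀ m A → All (λ k → Imin m A ≤ I (suc m) k A) (allFin (suc m))
  Imin≤I m A = foldr-⊓-≤ (λ k → I (suc m) k A) (I (suc m) zero A) (allFin (suc m))

  lowerBound*influenceSum≤ : ∀ n (A B : Family n) {J} ks → All (λ k → J ≤ I n k A) ks →
    J * influenceSum n B ks ≤ foldr (λ k s → I n k A * I n k B + s) 0ℚ ks
  lowerBound*influenceSum≤ n A B {J} []       []         = ≤-reflexive (*-zeroʳ J)
  lowerBound*influenceSum≤ n A B {J} (k ∷ ks) (J≤Iₖ ∷ hs) = begin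
    J * (I n k B + influenceSum n B ks)
      ≡⟨ *-distribˡ-+ J (I n k B) _ ⟩
    J * I n k B + J * influenceSum n B ks
      ≤⟨ +-mono-≤ (*-monoʳ-≤-nonNeg (I n k B) {{nonNegative (I-nonNeg n k B)}} J≤Iₖ)
                  (lowerBound*influenceSum≤ n A B ks hs) ⟩
    I n k A * I n k B + foldr (λ k s → I n k A * I n k B + s) 0ℚ ks ∎
    where open ≤-Reasoning

  ½J*∂≤Cor*2ⁿ : ∀ n (A B : Family n) {J} → All (λ k → J ≤ I n k A) (allFin n) →
    ¼ * sumInfl n A B ≤ Cor n A B →
    ½ * J * toℚ (edgeBoundary n B) ≤ Cor n A B * toℚ (2 ℕ.^ n)
  ½J*∂≤Cor*2ⁿ n A B {J} J≤I hyp = begin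
    ½ * J * toℚ E
      ≡⟨ regroup ⟩
    ¼ * (J * (toℚ 2 * toℚ E))
      ≡⟨ cong (λ z → ¼ * (J * z)) (trans (influenceSum*2ⁿ n B (allFin n)) (toℚ-homo-* 2 E)) ⟨
    ¼ * (J * (Σ * δ))
      ≡⟨ cong (¼ *_) (*-assoc J Σ δ) ⟨
    ¼ * (J * Σ * δ)
      ≡⟨ *-assoc ¼ (J * Σ) δ ⟨
    ¼ * (J * Σ) * δ
      ≤⟨ *-monoʳ-≤-nonNeg δ {{δ≥0}} (*-monoˡ-≤-nonNeg ¼ (lowerBound*influenceSum≤ n A B (allFin n) J≤I)) ⟩
    ¼ * sumInfl n A B * δ
      ≤⟨ *-monoʳ-≤-nonNeg δ {{δ≥0}} hyp ⟩
    Cor n A B * δ ∎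
    where
    open ≤-Reasoning
    E = edgeBoundary n B
    Σ = influenceSum n B (allFin n)
    δ = toℚ (2 ℕ.^ n)
    δ≥0 = nonNegative (toℚ-nonNeg (2 ℕ.^ n))
    regroup : ½ * J * toℚ E ≡ ¼ * (J * (toℚ 2 * toℚ E))
    regroup = shuffle ¼ (toℚ 2) J (toℚ E)
      where
      open +-*-Solver
      shuffle : ∀ a b c d → a * b * c * d ≡ a * (c * (b * d))
      shuffle = solve 4 (λ a b c d → a :* b :* c :* d := a :* (c :* (b :* d))) refl

  0≤c-of-bound : ∀ n {J c} e → 0ℚ ≤ J → ½ * J * toℚ e ≤ c * toℚ (2 ℕ.^ n) → 0ℚ ≤ c
  0≤c-of-bound n {J} {c} e 0≤J bound = *-cancelʳ-≤-pos δ {{positive (toℚ-pos (2 ℕ.^ n) {{ℕ.m^n≢0 2 n}})}}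
    (≤-trans (≤-reflexive (*-zeroˡ δ)) (≤-trans 0≤½Je bound))
    where
    δ = toℚ (2 ℕ.^ n)
    0≤½Je : 0ℚ ≤ ½ * J * toℚ e
    0≤½Je = *-nonNeg (*-nonNeg (nonNegative⁻¹ ½) 0≤J) (toℚ-nonNeg e)

  log₂Inv≤-of-boundary : ∀ N (B : Family N) → Extensional B → 0ℚ < μ N B → ∀ p q →
    toℚ (edgeBoundary N B) * toℚ q ≤ toℚ (count N B) * (p / 1) → Log₂InvLe (μ N B) p q
  log₂Inv≤-of-boundary N B ext 0<t (+ k) q Eq≤Sk =
    1≤t^q*2^k (2 ℕ.^ N) S q k {{ℕ.m^n≢0 2 N}} (μ*2ⁿ≡count N B)
      (isoperimetric-rescale N S E q k (edge-isoperimetry N B ext)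
        (toℚ-cancel-≤ (subst₂ _≤_ (sym (toℚ-homo-* E q)) (sym (toℚ-homo-* S k)) Eq≤Sk)))
    where
    S = count N B
    E = edgeBoundary N B
    instance _ = nonZero-of-/-pos S (2 ℕ.^ N) {{ℕ.m^n≢0 2 N}} 0<t
  log₂Inv≤-of-boundary N B ext 0<t -[1+ k ] q Eq≤S[-k-1] =
    contradiction (≤-<-trans (≤-trans 0≤Eq Eq≤S[-k-1]) S[-k-1]<0) (<-irrefl refl)
    where
    S = count N B
    E = edgeBoundary N B
    instance _ = nonZero-of-/-pos S (2 ℕ.^ N) {{ℕ.m^n≢0 2 N}} 0<t
    0≤Eq : 0ℚ ≤ toℚ E * toℚ q
    0≤Eq = *-nonNeg (toℚ-nonNeg E) (toℚ-nonNeg q)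
    S[-k-1]<0 : toℚ S * (-[1+ k ] / 1) < 0ℚ
    S[-k-1]<0 = <-≤-trans (*-monoʳ-<-pos (toℚ S) {{positive (toℚ-pos S)}} (neg-antimono-< (toℚ-pos (suc k))))
                          (≤-reflexive (*-zeroʳ (toℚ S)))

  log₂Inv≤-of-bound : ∀ N (B : Family N) → Extensional B → ∀ h c →
    h * toℚ (edgeBoundary N B) ≤ c * toℚ (2 ℕ.^ N) → 0ℚ < h * μ N B → 0ℚ < μ N B →
    ∀ p q → c * toℚ q ≡ h * μ N B * (p / 1) → Log₂InvLe (μ N B) p q
  log₂Inv≤-of-bound N B ext h c bound 0<ht 0<t p q cq≡htp = log₂Inv≤-of-boundary N B ext 0<t p q
    (cross-multiply {c = c} 0<h (toℚ-nonNeg q) bound (μ*2ⁿ≡count N B) cq≡htp)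
    where
    0<h : 0ℚ < h
    0<h = *-cancelʳ-<-nonNeg (μ N B) {{nonNegative (μ-nonNeg N B)}}
            (subst (_< h * μ N B) (sym (*-zeroˡ (μ N B))) 0<ht)

  2^m≤edgeBoundary : ∀ m (B : Family (suc m)) → Extensional B → μ (suc m) B ≡ ½ →
    2 ℕ.^ m ℕ.≤ edgeBoundary (suc m) B
  2^m≤edgeBoundary m B ext t≡½ = half-cube-boundary m (edgeBoundary (suc m) B)
    (subst (λ S → 2 ℕ.^ (suc m ℕ.* S) ℕ.≤ S ℕ.^ S ℕ.* 2 ℕ.^ edgeBoundary (suc m) B)
           (count≡2^m m B t≡½) (edge-isoperimetry (suc m) B ext))

  ¼J≤c-of-half : ∀ m (B : Family (suc m)) → Extensional B → ∀ {J c} → 0ℚ ≤ J →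
    ½ * J * toℚ (edgeBoundary (suc m) B) ≤ c * toℚ (2 ℕ.^ suc m) → μ (suc m) B ≡ ½ → ¼ * J ≤ c
  ¼J≤c-of-half m B ext {J} {c} 0≤J bound t≡½ =
    ¼J≤c 0≤J (toℚ-pos (2 ℕ.^ m) {{ℕ.m^n≢0 2 m}}) (toℚ-mono-≤ (2^m≤edgeBoundary m B ext t≡½))
      (subst (λ x → ½ * J * toℚ (edgeBoundary (suc m) B) ≤ c * x) (toℚ-homo-* 2 (2 ℕ.^ m)) bound)

open import Defs
open import Data.Nat using (ℕ; suc)
open import Data.Integer using (+_)
open import Data.Rational using (ℚ; _≤_; _*_; _/_; ½)
open import Data.Product using (_×_; _,_)
open import Relation.Binary.PropositionalEquality using (_≡_; refl)
open import Function using (const)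
open Boundary using (increasing⇒extensional; edgeBoundary)
open Influence

proposition2p2 : (m : ℕ) (A B : Family (suc m)) (t : ℚ) →
    Increasing A → Increasing B → μ (suc m) B ≡ t →
    ((+ 1 / 4) * sumInfl (suc m) A B ≤ Cor (suc m) A B) →
    GeTimesLog₂Inv (Cor (suc m) A B) (½ * Imin m A * t) t
    × (t ≡ ½ → (+ 1 / 4) * Imin m A ≤ Cor (suc m) A B)
proposition2p2 m A B .(μ (suc m) B) _ incB refl hyp =
  (const 0≤Cor , const 0≤Cor ,
   λ 0<b 0<t p q _ → log₂Inv≤-of-bound (suc m) B extB (½ * J) (Cor (suc m) A B) bound 0<b 0<t p q) ,
  ¼J≤c-of-half m B extB 0≤J bound
  where
  J = Imin m A
  0≤J = Imin-nonNeg m A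
  extB = increasing⇒extensional incB
  bound = ½J*∂≤Cor*2ⁿ (suc m) A B (Imin≤I m A) hyp
  0≤Cor = 0≤c-of-bound (suc m) (edgeBoundary (suc m) B) 0≤J bound
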